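{- Let $\alpha\in\mathcal{S}_r$ be an $r$-cycle and $\beta\in\mathcal{S}_s$ an $s$-cycle, with $r,s\ge2$, both Grassmanian, and not equal (i.e. $r\ne s$, or $r=s$ and $\alpha\neq\beta$). Then there is at most one Grassmanian permutation $\pi\in\mathcal{S}_{r+s}$ whose cycle decomposition consists of exactly two cycles, with supports $A$ and $B$, such that the restriction of $\pi$ to $A$ is isomorphic to $\alpha$ and the restriction of $\pi$ to $B$ is isomorphic to $\beta$.
   Context: $\mathcal{S}_m$ is the symmetric group on $[m]=\{1,\dots,m\}$; an $m$-cycle is a permutation in $\mathcal{S}_m$ consisting of a single cycle of length $m$. For $\pi\in\mathcal{S}_m$, $\operatorname{des}(\pi)$ is the number of $i\in[m-1]$ with $\pi(i)>\pi(i+1)$; $\pi$ is Grassmanian if $\operatorname{des}(\pi)\le1$. If $\pi(A)=A$ for $A\subseteq[m]$ with $|A|=r$, the restriction of $\pi$ to $A$ is isomorphic to $\alpha\in\mathcal{S}_r$ if $\pi\circ\phi=\phi\circ\alpha$, where $\phi:[r]\to A$ is the unique order-preserving bijection. -}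

module Defs where

open import Data.Nat using (ℕ; zero; suc; _≤_)
open import Data.Fin using (Fin; toℕ; inject₁; _<_; _<?_) renaming (suc to fsuc)
open import Data.Fin.Subset using (Subset; _∈_; _∉_)
open import Data.Fin.Permutation using (Permutation′; _⟨$⟩ʳ_)
open import Data.List using (length; filter; allFin)
open import Data.Product using (Σ; ∃; _×_; _,_)
open import Data.Sum using (_⊎_)
open import Relation.Binary.PropositionalEquality using (_≡_)
open import Relation.Nullary using (¬_)

_^[_]_ : ∀ {m} → Permutation′ m → ℕ → Fin m → Fin m
π ^[ zero ] x = x
π ^[ suc k ] x = π ⟨$⟩ʳ (π ^[ k ] x)

IsFullCycle : ∀ {m} → Permutation′ m → Set
IsFullCycle {m} π = ∀ (x y : Fin m) → ∃ λ k → π ^[ k ] x ≡ y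

des : ∀ {m} → Permutation′ m → ℕ
des {zero} π = 0
des {suc n} π =
  length (filter (λ (i : Fin n) → (π ⟨$⟩ʳ fsuc i) <? (π ⟨$⟩ʳ inject₁ i)) (allFin n))

Grassmannian : ∀ {m} → Permutation′ m → Set
Grassmannian π = des π ≤ 1

IsCycleSupport : ∀ {m} → Permutation′ m → Subset m → Set
IsCycleSupport {m} π A =
  (∃ λ (x : Fin m) → x ∈ A)
  × (∀ (x : Fin m) → x ∈ A → (π ⟨$⟩ʳ x) ∈ A)
  × (∀ (x y : Fin m) → x ∈ A → y ∈ A → ∃ λ k → π ^[ k ] x ≡ y)

TwoCyclesWithSupports : ∀ {m} → Permutation′ m → Subset m → Subset m → Set
TwoCyclesWithSupports {m} π A B =
  IsCycleSupport π A × IsCycleSupport π B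
  × (∀ (x : Fin m) → x ∈ A ⊎ x ∈ B)
  × (∀ (x : Fin m) → x ∈ A → x ∉ B)

IsOrderIsoOnto : ∀ {r m} → (Fin r → Fin m) → Subset m → Set
IsOrderIsoOnto {r} {m} φ A =
  (∀ (i j : Fin r) → i < j → φ i < φ j)
  × (∀ (i : Fin r) → φ i ∈ A)
  × (∀ (x : Fin m) → x ∈ A → ∃ λ i → φ i ≡ x)

-- π(A) = A and the restriction of π to A is isomorphic to α, i.e.
-- π ∘ φ = φ ∘ α for the unique order-preserving bijection φ : [r] → A.
RestrictionIso : ∀ {m r} → Permutation′ m → Subset m → Permutation′ r → Set
RestrictionIso {m} {r} π A α =
  (∀ (x : Fin m) → x ∈ A → (π ⟨$⟩ʳ x) ∈ A)
  × (∀ (x : Fin m) → (π ⟨$⟩ʳ x) ∈ A → x ∈ A)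
  × Σ (Fin r → Fin m) (λ φ → IsOrderIsoOnto φ A × (∀ (i : Fin r) → π ⟨$⟩ʳ (φ i) ≡ φ (α ⟨$⟩ʳ i)))

SamePerm : ∀ {r s} → Permutation′ r → Permutation′ s → Set
SamePerm {r} {s} α β =
  (r ≡ s) × (∀ (i : Fin r) (j : Fin s) → toℕ i ≡ toℕ j → toℕ (α ⟨$⟩ʳ i) ≡ toℕ (β ⟨$⟩ʳ j))

Admissible : ∀ {r s} → Permutation′ r → Permutation′ s → Permutation′ (r Data.Nat.+ s) → Set
Admissible {r} {s} α β π =
  Grassmannian π
  × Σ (Subset (r Data.Nat.+ s)) (λ A → Σ (Subset (r Data.Nat.+ s)) (λ B →
      TwoCyclesWithSupports π A B × RestrictionIso π A α × RestrictionIso π B β))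

{-# OPTIONS --safe #-}
-- A fixed-point-free Grassmannian permutation is a block of points with σ x > x followed by
-- a block of drops σ x < x, and it is increasing on each block.  Let π, π′ be admissible, with
-- order embeddings φ, ψ and φ′, ψ′ of α and β.  If some i, j are crossed (ψ j < φ i but
-- φ′ i < ψ′ j), comparing drops along these two inequalities shows that i and j are of the same
-- kind and that α i, β j are crossed again; so α read from i and β read from j have the same
-- drop word.  Between drop-sorted full cycles, points with equal drop words are matched by an
-- increasing map (a crossed pair would stay crossed forever, which no orbit allows), and such
-- maps in both directions force α = β.  Hence π and π′ interleave A and B in the same way, so
-- φ = φ′, ψ = ψ′ and π = π′.
module Submission where

open import Defs
open import Data.Nat using (ℕ; _≤_; _+_)
open import Data.Fin.Permutation using (Permutation′; _≈_)
open import Relation.Nullary using (¬_)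

open import Data.Nat as ℕ using (zero; suc; z≤n; s≤s; _*_)
import Data.Nat.Properties as ℕ
open import Data.Fin as Fin using (Fin; toℕ; inject₁; fromℕ; punchIn; _<_)
  renaming (zero to fzero; suc to fsuc)
import Data.Fin.Properties as Fin
import Data.Fin.Subset as FinSubset
open import Data.Fin.Permutation using (_⟨$⟩ʳ_)
open import Data.List using (List; length)
open import Data.List.Membership.Propositional using (_∈_)
open import Data.List.Membership.Propositional.Properties using (∈-filter⁺; ∈-allFin; ∈-length)
open import Data.List.Relation.Unary.Any using (here; there)
open import Data.Product using (∃; _×_; _,_; proj₁; proj₂; uncurry)
open import Data.Sum as Sum using (_⊎_; inj₁; inj₂; [_,_]′)
open import Function using (_∘_; _⇔_; mk⇔; Equivalence; Injection)
open import Function.Construct.Symmetry using (⇔-sym)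
open import Function.Properties.Inverse using (↔⇒↣)
open import Relation.Binary using (tri<; tri≈; tri>; _Preserves_⟶_)
open import Relation.Binary.PropositionalEquality
open import Relation.Nullary using (yes; no; contradiction)

open Equivalence using (to; from)

private
  variable
    a b m n r s : ℕ

perm-injective : (σ : Permutation′ m) {x y : Fin m} → σ ⟨$⟩ʳ x ≡ σ ⟨$⟩ʳ y → x ≡ y
perm-injective σ = Injection.injective (↔⇒↣ σ)

^[]-+ : (σ : Permutation′ m) (n k : ℕ) (x : Fin m) → σ ^[ n ] (σ ^[ k ] x) ≡ σ ^[ n + k ] x
^[]-+ σ zero    k x = refl
^[]-+ σ (suc n) k x = cong (σ ⟨$⟩ʳ_) (^[]-+ σ n k x)

Derangement : Permutation′ m → Set
Derangement {m} σ = ∀ (x : Fin m) → σ ⟨$⟩ʳ x ≢ x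

fullCycle⇒derangement : (σ : Permutation′ (suc (suc n))) → IsFullCycle σ → Derangement σ
fullCycle⇒derangement σ full x σx≡x with full x (punchIn x fzero)
... | k , σᵏx≡other = Fin.punchInᵢ≢i x fzero (trans (sym σᵏx≡other) (fixed k))
  where
    fixed : ∀ k → σ ^[ k ] x ≡ x
    fixed zero    = refl
    fixed (suc k) = trans (cong (σ ⟨$⟩ʳ_) (fixed k)) σx≡x

Ascending : (Fin (suc n) → ℕ) → Fin (suc n) → Fin (suc n) → Set
Ascending {n} g x y = ∀ (i : Fin n) → toℕ x ≤ toℕ i → i < y → g (inject₁ i) ℕ.< g (fsuc i)

-- That is, g y − g x ≥ y − x, with the terms moved so that no subtraction occurs.
ascending-run : (g : Fin (suc n) → ℕ) {x y : Fin (suc n)} →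
                toℕ x ≤ toℕ y → Ascending g x y → toℕ y + g x ≤ toℕ x + g y
ascending-run g {fzero} {fzero} _ _ = ℕ.≤-refl
ascending-run {suc n} g {fzero} {fsuc y} _ asc = ℕ.≤-trans (ℕ.+-monoʳ-< (toℕ y) first-step) rest
  where
    first-step : g fzero ℕ.< g (fsuc fzero)
    first-step = asc fzero z≤n (s≤s z≤n)
    rest : toℕ y + g (fsuc fzero) ≤ g (fsuc y)
    rest = ascending-run (g ∘ fsuc) {fzero} {y} z≤n (λ i _ i<y → asc (fsuc i) z≤n (s≤s i<y))
ascending-run {suc n} g {fsuc x} {fsuc y} (s≤s x≤y) asc =
  s≤s (ascending-run (g ∘ fsuc) x≤y (λ i x≤i i<y → asc (fsuc i) (s≤s x≤i) (s≤s i<y)))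

ascending⇒< : (g : Fin (suc n) → ℕ) {x y : Fin (suc n)} → x < y → Ascending g x y → g x ℕ.< g y
ascending⇒< g {x} {y} x<y asc = ℕ.+-cancelˡ-< (toℕ x) _ _ (begin-strict
  toℕ x + g x  <⟨ ℕ.+-monoˡ-< (g x) x<y ⟩
  toℕ y + g x  ≤⟨ ascending-run g (ℕ.<⇒≤ x<y) asc ⟩
  toℕ x + g y  ∎)
  where open ℕ.≤-Reasoning

ascending-from-0⇒≥ : (g : Fin (suc n) → ℕ) {x : Fin (suc n)} → Ascending g fzero x → toℕ x ≤ g x
ascending-from-0⇒≥ g {x} asc = ℕ.≤-trans (ℕ.m≤m+n (toℕ x) (g fzero)) (ascending-run g z≤n asc)

ascending-to-last⇒≤ : (g : Fin (suc n) → ℕ) {x : Fin (suc n)} →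
                      (∀ z → g z ≤ n) → Ascending g x (fromℕ n) → g x ≤ toℕ x
ascending-to-last⇒≤ {n} g {x} g≤n asc = ℕ.+-cancelˡ-≤ n _ _ (begin
  n + g x              ≡⟨ cong (_+ g x) (sym (Fin.toℕ-fromℕ n)) ⟩
  toℕ (fromℕ n) + g x  ≤⟨ ascending-run g (Fin.≤fromℕ x) asc ⟩
  toℕ x + g (fromℕ n)  ≤⟨ ℕ.+-monoʳ-≤ (toℕ x) (g≤n (fromℕ n)) ⟩
  toℕ x + n            ≡⟨ ℕ.+-comm (toℕ x) n ⟩
  n + toℕ x            ∎)
  where open ℕ.≤-Reasoning

module _ {g : Fin a → Fin b} (g-increasing : g Preserves _<_ ⟶ _<_) where

  increasing⇒injective : ∀ {i j} → g i ≡ g j → i ≡ j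
  increasing⇒injective {i} {j} gi≡gj with Fin.<-cmp i j
  ... | tri< i<j _ _ = contradiction (g-increasing i<j) (Fin.<-irrefl gi≡gj)
  ... | tri≈ _ i≡j _ = i≡j
  ... | tri> _ _ j<i = contradiction (g-increasing j<i) (Fin.<-irrefl (sym gi≡gj))

  increasing⇒reflects : ∀ {i j} → g i < g j → i < j
  increasing⇒reflects {i} {j} gi<gj with Fin.<-cmp i j
  ... | tri< i<j _ _  = i<j
  ... | tri≈ _ refl _ = contradiction gi<gj (Fin.<-irrefl refl)
  ... | tri> _ _ j<i  = contradiction (g-increasing j<i) (Fin.<-asym gi<gj)

  increasing⇒≤ : a ≤ b
  increasing⇒≤ = Fin.injective⇒≤ increasing⇒injective

increasing⇒toℕ-id : {g : Fin (suc n) → Fin b} → g Preserves _<_ ⟶ _<_ →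
                    b ≤ suc n → ∀ i → toℕ (g i) ≡ toℕ i
increasing⇒toℕ-id {n} {g = g} g-increasing b≤1+n i = ℕ.≤-antisym
  (ascending-to-last⇒≤ ĝ (λ z → ℕ.s≤s⁻¹ (ℕ.<-≤-trans (Fin.toℕ<n (g z)) b≤1+n)) ascending)
  (ascending-from-0⇒≥ ĝ ascending)
  where
    ĝ : Fin (suc n) → ℕ
    ĝ = toℕ ∘ g
    ascending : ∀ {x y} → Ascending ĝ x y
    ascending j _ _ = g-increasing (Fin.≤̄⇒inject₁< ℕ.≤-refl)

Drop : Permutation′ m → Fin m → Set
Drop σ x = σ ⟨$⟩ʳ x < x

record DropSorted (σ : Permutation′ m) : Set where
  field
    drop-upward             : ∀ {x y} → x < y → Drop σ x → Drop σ y
    increasing-within-block : ∀ {x y} → x < y → (Drop σ y → Drop σ x) → σ ⟨$⟩ʳ x < σ ⟨$⟩ʳ y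

open DropSorted

Descent : Permutation′ (suc n) → Fin n → Set
Descent σ i = σ ⟨$⟩ʳ fsuc i < σ ⟨$⟩ʳ inject₁ i

distinct-∈⇒2≤length : {A : Set} {xs : List A} {x y : A} → x ∈ xs → y ∈ xs → x ≢ y → 2 ≤ length xs
distinct-∈⇒2≤length (here refl) (here refl) x≢y = contradiction refl x≢y
distinct-∈⇒2≤length (here _)    (there y∈)  _   = s≤s (∈-length y∈)
distinct-∈⇒2≤length (there x∈)  (here _)    _   = s≤s (∈-length x∈)
distinct-∈⇒2≤length (there x∈)  (there y∈)  x≢y = ℕ.m≤n⇒m≤1+n (distinct-∈⇒2≤length x∈ y∈ x≢y)

grassmannian⇒descent-unique : (σ : Permutation′ (suc n)) → Grassmannian σ →
                              ∀ {i j} → Descent σ i → Descent σ j → i ≡ j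
grassmannian⇒descent-unique σ des≤1 {i} {j} dᵢ dⱼ with i Fin.≟ j
... | yes i≡j = i≡j
... | no  i≢j = contradiction des≤1 (ℕ.<⇒≱ two-descents)
  where
    two-descents : 2 ≤ des σ
    two-descents = distinct-∈⇒2≤length (∈-filter⁺ _ (∈-allFin i) dᵢ) (∈-filter⁺ _ (∈-allFin j) dⱼ) i≢j

¬descent⇒ascent : (σ : Permutation′ (suc n)) (i : Fin n) → ¬ Descent σ i → σ ⟨$⟩ʳ inject₁ i < σ ⟨$⟩ʳ fsuc i
¬descent⇒ascent σ i ¬descent =
  ℕ.≤∧≢⇒< (ℕ.≮⇒≥ ¬descent) (Fin.<⇒≢ (Fin.≤̄⇒inject₁< ℕ.≤-refl) ∘ perm-injective σ ∘ Fin.toℕ-injective)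

grassmannian⇒split : (σ : Permutation′ (suc n)) → Grassmannian σ →
                     ∃ λ t → ∀ i → suc (toℕ i) ≢ t → σ ⟨$⟩ʳ inject₁ i < σ ⟨$⟩ʳ fsuc i
grassmannian⇒split σ des≤1 with Fin.any? (λ i → σ ⟨$⟩ʳ fsuc i Fin.<? σ ⟨$⟩ʳ inject₁ i)
... | yes (d , descent-d) = suc (toℕ d) , λ i i≉d → ¬descent⇒ascent σ i
        (λ descent-i → i≉d (cong (suc ∘ toℕ) (grassmannian⇒descent-unique σ des≤1 descent-i descent-d)))
... | no  no-descent      = 0 , λ i _ → ¬descent⇒ascent σ i (λ descent-i → no-descent (i , descent-i))

module _ (σ : Permutation′ (suc n)) (σ-derangement : Derangement σ) (t : ℕ)
         (ascent : ∀ i → suc (toℕ i) ≢ t → σ ⟨$⟩ʳ inject₁ i < σ ⟨$⟩ʳ fsuc i) where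

  private
    σ̂ : Fin (suc n) → ℕ
    σ̂ = toℕ ∘ (σ ⟨$⟩ʳ_)

    ascent-below : ∀ {i : Fin n} → suc (toℕ i) ℕ.< t → σ ⟨$⟩ʳ inject₁ i < σ ⟨$⟩ʳ fsuc i
    ascent-below = ascent _ ∘ ℕ.<⇒≢

    ascent-above : ∀ {i : Fin n} → t ≤ toℕ i → σ ⟨$⟩ʳ inject₁ i < σ ⟨$⟩ʳ fsuc i
    ascent-above = ascent _ ∘ ℕ.>⇒≢ ∘ s≤s

  below-split⇒¬drop : ∀ {x} → toℕ x ℕ.< t → ¬ Drop σ x
  below-split⇒¬drop x<t = ℕ.≤⇒≯ (ascending-from-0⇒≥ σ̂ (λ _ _ i<x → ascent-below (ℕ.≤-<-trans i<x x<t)))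

  above-split⇒drop : ∀ {x} → t ≤ toℕ x → Drop σ x
  above-split⇒drop {x} t≤x = ℕ.≤∧≢⇒< σx≤x (σ-derangement x ∘ Fin.toℕ-injective)
    where
      σx≤x : σ̂ x ≤ toℕ x
      σx≤x = ascending-to-last⇒≤ σ̂ (Fin.toℕ≤pred[n] ∘ (σ ⟨$⟩ʳ_)) (λ _ x≤i _ → ascent-above (ℕ.≤-trans t≤x x≤i))

  one-side⇒increasing : ∀ {x y} → x < y → t ≤ toℕ x ⊎ toℕ y ℕ.< t → σ ⟨$⟩ʳ x < σ ⟨$⟩ʳ y
  one-side⇒increasing x<y (inj₁ t≤x) = ascending⇒< σ̂ x<y (λ _ x≤i _ → ascent-above (ℕ.≤-trans t≤x x≤i))
  one-side⇒increasing x<y (inj₂ y<t) = ascending⇒< σ̂ x<y (λ _ _ i<y → ascent-below (ℕ.≤-<-trans i<y y<t))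

  split⇒dropSorted : DropSorted σ
  split⇒dropSorted = record { drop-upward = upward ; increasing-within-block = within }
    where
      upward : ∀ {x y} → x < y → Drop σ x → Drop σ y
      upward x<y dx = above-split⇒drop (ℕ.≤-trans (ℕ.≮⇒≥ (λ x<t → below-split⇒¬drop x<t dx)) (ℕ.<⇒≤ x<y))

      within : ∀ {x y} → x < y → (Drop σ y → Drop σ x) → σ ⟨$⟩ʳ x < σ ⟨$⟩ʳ y
      within {x} {y} x<y dy⇒dx with t ℕ.≤? toℕ x | toℕ y ℕ.<? t
      ... | yes t≤x | _       = one-side⇒increasing x<y (inj₁ t≤x)
      ... | no  _   | yes y<t = one-side⇒increasing x<y (inj₂ y<t)
      ... | no  t≰x | no  y≮t =
        contradiction (dy⇒dx (above-split⇒drop (ℕ.≮⇒≥ y≮t))) (below-split⇒¬drop (ℕ.≰⇒> t≰x))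

grassmannian⇒dropSorted : (σ : Permutation′ (suc n)) → Grassmannian σ → Derangement σ → DropSorted σ
grassmannian⇒dropSorted σ des≤1 σ-derangement =
  uncurry (split⇒dropSorted σ σ-derangement) (grassmannian⇒split σ des≤1)

SameDropWord : Permutation′ a → Permutation′ b → Fin a → Fin b → Set
SameDropWord σ τ x y = ∀ n → Drop σ (σ ^[ n ] x) ⇔ Drop τ (τ ^[ n ] y)

module _ {σ : Permutation′ a} {τ : Permutation′ b} where

  sameDropWord-sym : ∀ {x y} → SameDropWord σ τ x y → SameDropWord τ σ y x
  sameDropWord-sym w = ⇔-sym ∘ w

  sameDropWord-^ : ∀ {x y} → SameDropWord σ τ x y → ∀ k → SameDropWord σ τ (σ ^[ k ] x) (τ ^[ k ] y)
  sameDropWord-^ {x} {y} w k n =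
    subst₂ (λ u v → Drop σ u ⇔ Drop τ v) (sym (^[]-+ σ n k x)) (sym (^[]-+ τ n k y)) (w (n + k))

¬iterates-always-< : (σ : Permutation′ m) (x : Fin m) (t : ℕ) → ¬ (∀ n → σ ^[ n ] x < σ ^[ n ] (σ ^[ t ] x))
¬iterates-always-< {m} σ x t always-< = ℕ.<⇒≱ (Fin.toℕ<n (σ ^[ m * t ] x)) (grows m)
  where
    shift : ∀ k → σ ^[ k * t ] (σ ^[ t ] x) ≡ σ ^[ suc k * t ] x
    shift k = trans (^[]-+ σ (k * t) t x) (cong (λ e → σ ^[ e ] x) (ℕ.+-comm (k * t) t))

    grows : ∀ k → k ≤ toℕ (σ ^[ k * t ] x)
    grows zero    = z≤n
    grows (suc k) = ℕ.≤-<-trans (grows k) (subst (σ ^[ k * t ] x <_) (shift k) (always-< (k * t)))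

module _ {σ : Permutation′ a} {τ : Permutation′ b} (σ-sorted : DropSorted σ) (τ-sorted : DropSorted τ) where

  crossing-step : ∀ {x₁ x₂ y₁ y₂} → x₁ < x₂ → toℕ y₂ ≤ toℕ y₁ →
                  (Drop σ x₁ ⇔ Drop τ y₁) → (Drop σ x₂ ⇔ Drop τ y₂) →
                  σ ⟨$⟩ʳ x₁ < σ ⟨$⟩ʳ x₂ × toℕ (τ ⟨$⟩ʳ y₂) ≤ toℕ (τ ⟨$⟩ʳ y₁)
  crossing-step x₁<x₂ y₂≤y₁ w₁ w₂ with ℕ.m≤n⇒m<n∨m≡n y₂≤y₁
  ... | inj₁ y₂<y₁ =
    increasing-within-block σ-sorted x₁<x₂ (from w₁ ∘ drop-upward τ-sorted y₂<y₁ ∘ to w₂) ,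
    ℕ.<⇒≤ (increasing-within-block τ-sorted y₂<y₁ (to w₂ ∘ drop-upward σ-sorted x₁<x₂ ∘ from w₁))
  ... | inj₂ y₂≡y₁ with refl ← Fin.toℕ-injective y₂≡y₁ =
    increasing-within-block σ-sorted x₁<x₂ (from w₁ ∘ to w₂) , ℕ.≤-refl

  crossing-iterates : ∀ {x₁ x₂ y₁ y₂} → x₁ < x₂ → toℕ y₂ ≤ toℕ y₁ →
                      SameDropWord σ τ x₁ y₁ → SameDropWord σ τ x₂ y₂ →
                      ∀ n → σ ^[ n ] x₁ < σ ^[ n ] x₂ × toℕ (τ ^[ n ] y₂) ≤ toℕ (τ ^[ n ] y₁)
  crossing-iterates x₁<x₂ y₂≤y₁ w₁ w₂ zero = x₁<x₂ , y₂≤y₁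
  crossing-iterates x₁<x₂ y₂≤y₁ w₁ w₂ (suc n) with crossing-iterates x₁<x₂ y₂≤y₁ w₁ w₂ n
  ... | xₙ<xₙ , yₙ≤yₙ = crossing-step xₙ<xₙ yₙ≤yₙ (w₁ n) (w₂ n)

  sameDropWord-monotone : IsFullCycle σ → ∀ {x₁ x₂ y₁ y₂} →
                          SameDropWord σ τ x₁ y₁ → SameDropWord σ τ x₂ y₂ → x₁ < x₂ → y₁ < y₂
  sameDropWord-monotone σ-full {x₁} {x₂} {y₁} {y₂} w₁ w₂ x₁<x₂ with toℕ y₁ ℕ.<? toℕ y₂ | σ-full x₁ x₂
  ... | yes y₁<y₂ | _        = y₁<y₂
  ... | no  y₁≮y₂ | t , refl =
    contradiction (proj₁ ∘ crossing-iterates x₁<x₂ (ℕ.≮⇒≥ y₁≮y₂) w₁ w₂) (¬iterates-always-< σ x₁ t)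

sameDropWord-functional : {σ : Permutation′ a} {τ : Permutation′ b} → DropSorted σ → DropSorted τ →
                          IsFullCycle τ → ∀ {x y₁ y₂} →
                          SameDropWord σ τ x y₁ → SameDropWord σ τ x y₂ → y₁ ≡ y₂
sameDropWord-functional {σ = σ} {τ} σ-sorted τ-sorted τ-full {x} w₁ w₂ =
  Fin.toℕ-injective (ℕ.≤-antisym (ℕ.≮⇒≥ (no-smaller w₂ w₁)) (ℕ.≮⇒≥ (no-smaller w₁ w₂)))
  where
    no-smaller : ∀ {y y′} → SameDropWord σ τ x y → SameDropWord σ τ x y′ → ¬ y < y′
    no-smaller w w′ y<y′ = Fin.<-irrefl refl
      (sameDropWord-monotone τ-sorted σ-sorted τ-full (sameDropWord-sym w) (sameDropWord-sym w′) y<y′)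

module Follow {σ : Permutation′ a} {τ : Permutation′ b} (σ-sorted : DropSorted σ) (τ-sorted : DropSorted τ)
              (σ-full : IsFullCycle σ) {x₀ y₀} (w₀ : SameDropWord σ τ x₀ y₀) where

  follow : Fin a → Fin b
  follow x = τ ^[ proj₁ (σ-full x₀ x) ] y₀

  follow-sameDropWord : ∀ x → SameDropWord σ τ x (follow x)
  follow-sameDropWord x with σ-full x₀ x
  ... | k , refl = sameDropWord-^ w₀ k

  follow-increasing : follow Preserves _<_ ⟶ _<_
  follow-increasing {x} {x′} =
    sameDropWord-monotone σ-sorted τ-sorted σ-full (follow-sameDropWord x) (follow-sameDropWord x′)

sameDropWord⇒samePerm : {α : Permutation′ (suc r)} {β : Permutation′ (suc s)} →
                        DropSorted α → DropSorted β → IsFullCycle α → IsFullCycle β →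
                        ∀ {i₀ j₀} → SameDropWord α β i₀ j₀ → SamePerm α β
sameDropWord⇒samePerm {r} {s} {α} {β} α-sorted β-sorted α-full β-full w₀ = ℕ.≤-antisym r≤s s≤r , same-values
  where
    module F = Follow α-sorted β-sorted α-full w₀
    module B = Follow β-sorted α-sorted β-full (sameDropWord-sym w₀)

    r≤s : suc r ≤ suc s
    r≤s = increasing⇒≤ F.follow-increasing

    s≤r : suc s ≤ suc r
    s≤r = increasing⇒≤ B.follow-increasing

    f-id : ∀ i → toℕ (F.follow i) ≡ toℕ i
    f-id = increasing⇒toℕ-id F.follow-increasing s≤r

    same-values : ∀ i j → toℕ i ≡ toℕ j → toℕ (α ⟨$⟩ʳ i) ≡ toℕ (β ⟨$⟩ʳ j)
    same-values i j i≡j with refl ← Fin.toℕ-injective (trans (f-id i) i≡j) = begin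
      toℕ (α ⟨$⟩ʳ i)               ≡⟨ sym (f-id (α ⟨$⟩ʳ i)) ⟩
      toℕ (F.follow (α ⟨$⟩ʳ i))    ≡⟨ cong toℕ (sameDropWord-functional α-sorted β-sorted β-full
                                          (F.follow-sameDropWord (α ⟨$⟩ʳ i))
                                          (sameDropWord-^ (F.follow-sameDropWord i) 1)) ⟩
      toℕ (β ⟨$⟩ʳ F.follow i)      ∎
      where open ≡-Reasoning

record Embedding (α : Permutation′ a) (π : Permutation′ m) : Set where
  field
    ι           : Fin a → Fin m
    increasing  : ι Preserves _<_ ⟶ _<_
    intertwines : ∀ i → π ⟨$⟩ʳ ι i ≡ ι (α ⟨$⟩ʳ i)

  drop⁺ : ∀ {i} → Drop α i → Drop π (ι i)
  drop⁺ {i} αi<i = subst (_< ι i) (sym (intertwines i)) (increasing αi<i)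

  drop⁻ : ∀ {i} → Drop π (ι i) → Drop α i
  drop⁻ {i} πιi<ιi = increasing⇒reflects increasing (subst (_< ι i) (intertwines i) πιi<ιi)

  derangement : Derangement α → ∀ i → π ⟨$⟩ʳ ι i ≢ ι i
  derangement α-derangement i πιi≡ιi =
    α-derangement i (increasing⇒injective increasing (trans (sym (intertwines i)) πιi≡ιi))

record Interleaving (α : Permutation′ r) (β : Permutation′ s) (π : Permutation′ (r + s)) : Set where
  field
    left     : Embedding α π
    right    : Embedding β π
    disjoint : ∀ i j → Embedding.ι left i ≢ Embedding.ι right j
    covers   : ∀ x → (∃ λ i → Embedding.ι left i ≡ x) ⊎ (∃ λ j → Embedding.ι right j ≡ x)

  φ : Fin r → Fin (r + s)
  φ = Embedding.ι left

  ψ : Fin s → Fin (r + s)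
  ψ = Embedding.ι right

  label : Fin r ⊎ Fin s → Fin (r + s)
  label = [ φ , ψ ]′

  label-surjective : ∀ x → ∃ λ c → label c ≡ x
  label-surjective x with covers x
  ... | inj₁ (i , φi≡x) = inj₁ i , φi≡x
  ... | inj₂ (j , ψj≡x) = inj₂ j , ψj≡x

  label-intertwines : ∀ c → π ⟨$⟩ʳ label c ≡ label (Sum.map (α ⟨$⟩ʳ_) (β ⟨$⟩ʳ_) c)
  label-intertwines (inj₁ i) = Embedding.intertwines left i
  label-intertwines (inj₂ j) = Embedding.intertwines right j

  derangement : Derangement α → Derangement β → Derangement π
  derangement α-derangement β-derangement x with covers x
  ... | inj₁ (i , refl) = Embedding.derangement left α-derangement i
  ... | inj₂ (j , refl) = Embedding.derangement right β-derangement j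

admissible⇒interleaving : {α : Permutation′ r} {β : Permutation′ s} {π : Permutation′ (r + s)} →
                          Admissible α β π → Interleaving α β π
admissible⇒interleaving
  (_ , _ , B , (_ , _ , A∪B , A∩B=∅) , (_ , _ , φ , (φ-mono , φ∈A , φ-onto) , πφ≡φα)
                                     , (_ , _ , ψ , (ψ-mono , ψ∈B , ψ-onto) , πψ≡ψβ)) = record
  { left     = record { ι = φ ; increasing = λ {i j} → φ-mono i j ; intertwines = πφ≡φα }
  ; right    = record { ι = ψ ; increasing = λ {i j} → ψ-mono i j ; intertwines = πψ≡ψβ }
  ; disjoint = λ i j φi≡ψj → A∩B=∅ (φ i) (φ∈A i) (subst (FinSubset._∈ B) (sym φi≡ψj) (ψ∈B j))
  ; covers   = λ x → Sum.map (φ-onto x) (ψ-onto x) (A∪B x)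
  }

module Comparison {α : Permutation′ r} {β : Permutation′ s} {π π′ : Permutation′ (r + s)}
                  (I : Interleaving α β π) (I′ : Interleaving α β π′) where
  private
    module I  = Interleaving I
    module I′ = Interleaving I′
    module L  = Embedding I.left
    module R  = Embedding I.right
    module L′ = Embedding I′.left
    module R′ = Embedding I′.right

  Crossed : Fin r → Fin s → Set
  Crossed i j = I.ψ j < I.φ i × I′.φ i < I′.ψ j

  module _ (π-sorted : DropSorted π) (π′-sorted : DropSorted π′) where

    crossed-step : ∀ {i j} → Crossed i j → (Drop α i ⇔ Drop β j) × Crossed (α ⟨$⟩ʳ i) (β ⟨$⟩ʳ j)
    crossed-step {i} {j} (ψj<φi , φ′i<ψ′j) = mk⇔ α⇒β β⇒α , next , next′
      where
        β⇒α : Drop β j → Drop α i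
        β⇒α = L.drop⁻ ∘ drop-upward π-sorted ψj<φi ∘ R.drop⁺

        α⇒β : Drop α i → Drop β j
        α⇒β = R′.drop⁻ ∘ drop-upward π′-sorted φ′i<ψ′j ∘ L′.drop⁺

        next : I.ψ (β ⟨$⟩ʳ j) < I.φ (α ⟨$⟩ʳ i)
        next = subst₂ _<_ (R.intertwines j) (L.intertwines i)
          (increasing-within-block π-sorted ψj<φi (R.drop⁺ ∘ α⇒β ∘ L.drop⁻))

        next′ : I′.φ (α ⟨$⟩ʳ i) < I′.ψ (β ⟨$⟩ʳ j)
        next′ = subst₂ _<_ (L′.intertwines i) (R′.intertwines j)
          (increasing-within-block π′-sorted φ′i<ψ′j (L′.drop⁺ ∘ β⇒α ∘ R′.drop⁻))

    crossed⇒sameDropWord : ∀ {i j} → Crossed i j → SameDropWord α β i j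
    crossed⇒sameDropWord {i} {j} crossed n = proj₁ (crossed-step (iterate n))
      where
        iterate : ∀ n → Crossed (α ^[ n ] i) (β ^[ n ] j)
        iterate zero    = crossed
        iterate (suc n) = proj₂ (crossed-step (iterate n))

label-order : {α : Permutation′ r} {β : Permutation′ s} {π π′ : Permutation′ (r + s)}
              (I : Interleaving α β π) (I′ : Interleaving α β π′) →
              (∀ {i j} → ¬ Comparison.Crossed I I′ i j) → (∀ {i j} → ¬ Comparison.Crossed I′ I i j) →
              ∀ c d → Interleaving.label I c < Interleaving.label I d →
              Interleaving.label I′ c < Interleaving.label I′ d
label-order I I′ _ _ (inj₁ i) (inj₁ i′) =
  Embedding.increasing (Interleaving.left I′) ∘ increasing⇒reflects (Embedding.increasing (Interleaving.left I))
label-order I I′ _ _ (inj₂ j) (inj₂ j′) =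
  Embedding.increasing (Interleaving.right I′) ∘ increasing⇒reflects (Embedding.increasing (Interleaving.right I))
label-order I I′ no-cross _ (inj₂ j) (inj₁ i) ψj<φi =
  ℕ.≤∧≢⇒< (ℕ.≮⇒≥ (λ φ′i<ψ′j → no-cross (ψj<φi , φ′i<ψ′j)))
          (Interleaving.disjoint I′ i j ∘ sym ∘ Fin.toℕ-injective)
label-order I I′ _ no-cross′ (inj₁ i) (inj₂ j) φi<ψj =
  ℕ.≤∧≢⇒< (ℕ.≮⇒≥ (λ ψ′j<φ′i → no-cross′ (ψ′j<φ′i , φi<ψj)))
          (Interleaving.disjoint I′ i j ∘ Fin.toℕ-injective)

sameOrder⇒≗ : {X : Set} {e e′ : X → Fin (suc n)} → (∀ x → ∃ λ c → e c ≡ x) →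
              (∀ c d → e c < e d → e′ c < e′ d) → (∀ c d → e′ c < e′ d → e c < e d) →
              ∀ c → e c ≡ e′ c
sameOrder⇒≗ {n} {e = e} {e′} e-surjective e⇒e′ e′⇒e c = begin
  e c      ≡⟨ Fin.toℕ-injective (sym (increasing⇒toℕ-id h-increasing ℕ.≤-refl (e c))) ⟩
  h (e c)  ≡⟨ e′-respects-e (proj₂ (e-surjective (e c))) ⟩
  e′ c     ∎
  where
    open ≡-Reasoning

    h : Fin (suc n) → Fin (suc n)
    h = e′ ∘ proj₁ ∘ e-surjective

    h-increasing : h Preserves _<_ ⟶ _<_
    h-increasing {x} {y} = e⇒e′ _ _ ∘ subst₂ _<_ (sym (proj₂ (e-surjective x))) (sym (proj₂ (e-surjective y)))

    e′-respects-e : ∀ {c d} → e c ≡ e d → e′ c ≡ e′ d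
    e′-respects-e {c} {d} ec≡ed = Fin.toℕ-injective (ℕ.≤-antisym
      (ℕ.≮⇒≥ (Fin.<-irrefl (sym ec≡ed) ∘ e′⇒e d c))
      (ℕ.≮⇒≥ (Fin.<-irrefl ec≡ed ∘ e′⇒e c d)))

interleaving-determines : {α : Permutation′ r} {β : Permutation′ s} {π π′ : Permutation′ (r + s)}
                          (I : Interleaving α β π) (I′ : Interleaving α β π′) →
                          (∀ c → Interleaving.label I c ≡ Interleaving.label I′ c) → π ≈ π′
interleaving-determines {α = α} {β} {π} {π′} I I′ same-labels x with Interleaving.label-surjective I x
... | c , refl = begin
  π ⟨$⟩ʳ label c            ≡⟨ Interleaving.label-intertwines I c ⟩
  label (act c)             ≡⟨ same-labels (act c) ⟩
  label′ (act c)            ≡⟨ sym (Interleaving.label-intertwines I′ c) ⟩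
  π′ ⟨$⟩ʳ label′ c          ≡⟨ cong (π′ ⟨$⟩ʳ_) (sym (same-labels c)) ⟩
  π′ ⟨$⟩ʳ label c           ∎
  where
    open ≡-Reasoning
    label  = Interleaving.label I
    label′ = Interleaving.label I′
    act = Sum.map (α ⟨$⟩ʳ_) (β ⟨$⟩ʳ_)

lemma3p5 : ∀ (r s : ℕ) → 2 ≤ r → 2 ≤ s
    → (α : Permutation′ r) (β : Permutation′ s)
    → IsFullCycle α → IsFullCycle β
    → Grassmannian α → Grassmannian β
    → ¬ SamePerm α β
    → (π π′ : Permutation′ (r + s))
    → Admissible α β π → Admissible α β π′
    → π ≈ π′
lemma3p5 (suc (suc r)) (suc (suc s)) (s≤s (s≤s z≤n)) (s≤s (s≤s z≤n))
         α β α-full β-full α-grassmannian β-grassmannian α≉β π π′ π-admissible π′-admissible =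
  interleaving-determines I I′ (sameOrder⇒≗ (Interleaving.label-surjective I)
    (label-order I I′ (no-crossing I I′ π-sorted π′-sorted) (no-crossing I′ I π′-sorted π-sorted))
    (label-order I′ I (no-crossing I′ I π′-sorted π-sorted) (no-crossing I I′ π-sorted π′-sorted)))
  where
    α-derangement : Derangement α
    α-derangement = fullCycle⇒derangement α α-full

    β-derangement : Derangement β
    β-derangement = fullCycle⇒derangement β β-full

    α-sorted : DropSorted α
    α-sorted = grassmannian⇒dropSorted α α-grassmannian α-derangement

    β-sorted : DropSorted β
    β-sorted = grassmannian⇒dropSorted β β-grassmannian β-derangement

    I : Interleaving α β π
    I = admissible⇒interleaving π-admissible

    I′ : Interleaving α β π′
    I′ = admissible⇒interleaving π′-admissible

    π-sorted : DropSorted π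
    π-sorted = grassmannian⇒dropSorted π (proj₁ π-admissible) (Interleaving.derangement I α-derangement β-derangement)

    π′-sorted : DropSorted π′
    π′-sorted = grassmannian⇒dropSorted π′ (proj₁ π′-admissible) (Interleaving.derangement I′ α-derangement β-derangement)

    no-crossing : ∀ {ρ ρ′} (J : Interleaving α β ρ) (J′ : Interleaving α β ρ′) → DropSorted ρ → DropSorted ρ′ →
                  ∀ {i j} → ¬ Comparison.Crossed J J′ i j
    no-crossing J J′ ρ-sorted ρ′-sorted = α≉β ∘ sameDropWord⇒samePerm α-sorted β-sorted α-full β-full
                                              ∘ Comparison.crossed⇒sameDropWord J J′ ρ-sorted ρ′-sorted
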